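{- Let $\mathcal{A}$ be a family of finite sets and let $\tau,q\ge1$. For every family $\mathcal{F}\subset\mathcal{A}$ there exist a family $\mathcal{S}$ of sets of size at most $q$ and a family $\mathcal{F}'\subset\mathcal{F}$ such that: (i) every set in $\mathcal{F}\setminus\mathcal{F}'$ contains at least one set of $\mathcal{S}$; (ii) for every $B\in\mathcal{S}$ there is a family $\mathcal{F}_B\subset\mathcal{F}$ such that $\mathcal{F}_B(B)$ is $(\mathcal{A}(B),\tau)$-homogeneous; (iii) $|\mathcal{F}'|\le\tau^{ -q-1}|\mathcal{A}|$.
   Context: For a family $\mathcal{G}$ and a set $S$, $\mathcal{G}(S)=\{A\setminus S: A\in\mathcal{G},\ S\subset A\}$. For families $\mathcal{G}\subset\mathcal{B}$ and $\tau\ge1$, $\mathcal{G}$ is $(\mathcal{B},\tau)$-homogeneous if for every set $S$, $\frac{|\mathcal{G}(S)|}{|\mathcal{G}|}\le\tau^{|S|}\frac{|\mathcal{B}(S)|}{|\mathcal{B}|}$.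
   Formalization: The parameter τ ranges over the rationals at least 1, both in the lemma and in the definition of $(\mathcal{A}(B),\tau)$-homogeneity. -}

module Defs where

open import Data.Nat using (ℕ; zero; suc; _+_)
open import Data.Bool using (Bool; true; false; _∧_; _∨_; not; if_then_else_; T)
open import Data.List using (List; []; _∷_; map; _++_; foldr)
open import Data.Vec using ([]; _∷_)
open import Data.Fin.Subset using (Subset; inside; outside; _∩_; ∁)
open import Data.Integer using (+_)
open import Data.Rational using (ℚ; 1ℚ; _*_; _/_)

Family : ℕ → Set
Family n = Subset n → Bool

-- All subsets of Fin n (each exactly once).
allSubsets : (n : ℕ) → List (Subset n)
allSubsets zero = [] ∷ []
allSubsets (suc n) = map (outside ∷_) (allSubsets n) ++ map (inside ∷_) (allSubsets n)

card : {n : ℕ} → Family n → ℕ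
card {n} F = foldr (λ X k → (if F X then 1 else 0) + k) 0 (allSubsets n)

_⊆ᵇ_ : {n : ℕ} → Subset n → Subset n → Bool
[] ⊆ᵇ [] = true
(x ∷ xs) ⊆ᵇ (y ∷ ys) = (not x ∨ y) ∧ (xs ⊆ᵇ ys)

_==ᵇ_ : {n : ℕ} → Subset n → Subset n → Bool
[] ==ᵇ [] = true
(x ∷ xs) ==ᵇ (y ∷ ys) = ((x ∧ y) ∨ (not x ∧ not y)) ∧ (xs ==ᵇ ys)

_∖_ : {n : ℕ} → Subset n → Subset n → Subset n
A ∖ S = A ∩ ∁ S

anyL : {A : Set} → (A → Bool) → List A → Bool
anyL p = foldr (λ x b → p x ∨ b) false

restrict : {n : ℕ} → Family n → Subset n → Family n
restrict {n} G S X = anyL (λ A → G A ∧ (S ⊆ᵇ A) ∧ ((A ∖ S) ==ᵇ X)) (allSubsets n)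

_⊆F_ : {n : ℕ} → Family n → Family n → Set
G ⊆F B = ∀ X → T (G X) → T (B X)

toℚ : ℕ → ℚ
toℚ k = (+ k) / 1

_^ℚ_ : ℚ → ℕ → ℚ
x ^ℚ zero = 1ℚ
x ^ℚ suc k = x * (x ^ℚ k)

open import Data.Nat using (_<_)
open import Data.Product using (_×_)
open import Data.Fin.Subset using (∣_∣)
import Data.Rational as Q

-- 𝒢 is (ℬ,τ)-homogeneous: 𝒢 ⊆ ℬ, 𝒢 nonempty (so the ratio |𝒢(S)|/|𝒢| is defined;
-- then ℬ is nonempty too), and for every S,
--   |𝒢(S)|/|𝒢| ≤ τ^|S| |ℬ(S)|/|ℬ|, written cross-multiplied:
--   |𝒢(S)|·|ℬ| ≤ τ^|S|·|ℬ(S)|·|𝒢|.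
Homogeneous : {n : ℕ} → Family n → Family n → ℚ → Set
Homogeneous {n} G B τ =
  G ⊆F B × 0 < card G ×
  (∀ (S : Subset n) →
     toℚ (card (restrict G S)) * toℚ (card B)
       Q.≤ (τ ^ℚ ∣ S ∣) * toℚ (card (restrict B S)) * toℚ (card G))

-- While τ^(q+1) |ℱ| > |𝒜|, pick S maximising the density
-- |ℱ(S)| / (τ^|S| |𝒜(S)|).  Comparing S with ∅ gives τ^|S| |ℱ| ≤ (|ℱ(S)| / |𝒜(S)|) |𝒜| ≤ |𝒜|,
-- so |S| ≤ q and ℱ(S) ≠ ∅.  Comparing S with S ∪ S′ for S′ disjoint from S is exactly the
-- homogeneity inequality for ℱ(S) inside 𝒜(S) at S′, because ℱ(S)(S′) = ℱ(S ∪ S′); when S′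
-- meets S, ℱ(S)(S′) is empty.  Put S into 𝒮 and recurse on the members of ℱ not containing S,
-- a strictly smaller family since ℱ(S) ≠ ∅.
module Submission where

open import Defs
open import Data.Nat as ℕ using (ℕ; zero; suc; _+_; _≤_; _<_; z≤n; s≤s)
import Data.Nat.Properties as ℕ
open import Data.Nat.Induction using (<-wellFounded)
open import Data.Nat.Coprimality using (1-coprimeTo) renaming (sym to coprime-sym)
open import Data.Integer as ℤ using (+_)
import Data.Integer.Properties as ℤ
open import Data.Rational
  using (ℚ; 0ℚ; 1ℚ; mkℚ; *≤*; *<*; NonZero; 1/_; _÷_; positive; nonNegative; >-nonZero)
  renaming (_≤_ to _≤ℚ_; _<_ to _<ℚ_; _*_ to _*ℚ_)
import Data.Rational.Properties as ℚ
open import Data.Rational.Solver using (module +-*-Solver)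
open import Data.Bool using (Bool; true; false; not; _∧_; _∨_; T; if_then_else_)
open import Data.Bool.Properties using (T-∧; T-∨; T-≡)
open import Data.Bool.ListAction using (any)
open import Data.Unit using (tt)
open import Data.Empty using (⊥-elim)
open import Data.Product using (Σ; ∃; _×_; _,_; proj₁; proj₂)
open import Data.Sum using (inj₁; inj₂; [_,_]′)
open import Data.List using (List; []; _∷_; map; foldr)
open import Data.List.Membership.Propositional using (_∈_; lose)
open import Data.List.Membership.Propositional.Properties using (∈-map⁺; ∈-++⁺ˡ; ∈-++⁺ʳ)
open import Data.List.Relation.Unary.Any using (here; there; satisfied)
open import Data.List.Relation.Unary.Any.Properties using (any⁺; any⁻)
import Data.List.Relation.Unary.All as All
open import Relation.Binary.Bundles using (DecTotalOrder)
open import Data.List.Extrema (DecTotalOrder.totalOrder ℚ.≤-decTotalOrder) using (argmax; f[xs]≤f[argmax])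
open import Data.Vec using ([]; _∷_)
import Data.Vec.Base as Vec
open import Data.Vec.Properties using (map-replicate)
open import Data.Fin.Subset using (Subset; inside; outside; _⊆_; _∪_; _∩_; ∁; ∣_∣) renaming (⊥ to ∅)
open import Data.Fin.Subset.Properties
  using ( ⊆-refl; ⊆-trans; out⊆; in⊆in; drop-∷-⊆; ⊥⊆; p⊆p∪q; q⊆p∪q; x∈p∪q⁻
        ; p∩q⊆p; p∩q⊆q; x∈p∩q⁺; ∩-identityʳ; ∣⊥∣≡0; _⊆?_)
open import Function using (_∘_; Equivalence)
open import Induction.WellFounded using (Acc; acc)
open import Relation.Binary.PropositionalEquality
open import Relation.Nullary using (¬_)
open import Relation.Nullary.Decidable using (toSum)

open Equivalence using (to; from)
open +-*-Solver using (solve; _:*_; _:=_)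

private variable
  n : ℕ
  F G : Family n
  A : Subset n

1≤⇒0< : ∀ {x} → 1ℚ ≤ℚ x → 0ℚ <ℚ x
1≤⇒0< = ℚ.<-≤-trans (ℚ.positive⁻¹ 1ℚ)

*-nonNeg : ∀ {x y} → 0ℚ ≤ℚ x → 0ℚ ≤ℚ y → 0ℚ ≤ℚ x *ℚ y
*-nonNeg {x} {y} 0≤x 0≤y =
  ℚ.nonNegative⁻¹ _ {{ℚ.nonNeg*nonNeg⇒nonNeg x {{nonNegative 0≤x}} y {{nonNegative 0≤y}}}}

*-pos : ∀ {x y} → 0ℚ <ℚ x → 0ℚ <ℚ y → 0ℚ <ℚ x *ℚ y
*-pos {x} {y} 0<x 0<y = ℚ.positive⁻¹ _ {{ℚ.pos*pos⇒pos x {{positive 0<x}} y {{positive 0<y}}}}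

toℚ≡mkℚ : ∀ k → toℚ k ≡ mkℚ (+ k) 0 (coprime-sym (1-coprimeTo k))
toℚ≡mkℚ k = ℚ.normalize-coprime (coprime-sym (1-coprimeTo k))

toℚ-mono-≤ : ∀ {m n} → m ≤ n → toℚ m ≤ℚ toℚ n
toℚ-mono-≤ {m} {n} m≤n rewrite toℚ≡mkℚ m | toℚ≡mkℚ n =
  *≤* (subst₂ ℤ._≤_ (sym (ℤ.*-identityʳ (+ m))) (sym (ℤ.*-identityʳ (+ n))) (ℤ.+≤+ m≤n))

toℚ-mono-< : ∀ {m n} → m < n → toℚ m <ℚ toℚ n
toℚ-mono-< {m} {n} m<n rewrite toℚ≡mkℚ m | toℚ≡mkℚ n =
  *<* (subst₂ ℤ._<_ (sym (ℤ.*-identityʳ (+ m))) (sym (ℤ.*-identityʳ (+ n))) (ℤ.+<+ m<n))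

toℚ-nonNeg : ∀ k → 0ℚ ≤ℚ toℚ k
toℚ-nonNeg k = toℚ-mono-≤ {0} {k} z≤n

toℚ-pos : ∀ {k} → 0 < k → 0ℚ <ℚ toℚ k
toℚ-pos {k} = toℚ-mono-< {0} {k}

toℚ-suc-nonZero : ∀ m → NonZero (toℚ (suc m))
toℚ-suc-nonZero m = >-nonZero (toℚ-pos {suc m} (s≤s z≤n))

*-monoʳ-≤-toℚ : ∀ m {x y} → x ≤ℚ y → x *ℚ toℚ m ≤ℚ y *ℚ toℚ m
*-monoʳ-≤-toℚ m = ℚ.*-monoʳ-≤-nonNeg (toℚ m) {{nonNegative (toℚ-nonNeg m)}}

-- k / m, with the junk value 0 for m = 0; the lemmas below assume k ≤ m, which forces k = 0
-- in the junk case, so that (k ÷ℕ m) * m = k holds throughout.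
_÷ℕ_ : ℕ → ℕ → ℚ
k ÷ℕ zero  = 0ℚ
k ÷ℕ suc m = (toℚ k ÷ toℚ (suc m)) {{toℚ-suc-nonZero m}}

÷ℕ-*-cancel : ∀ {k m} → k ≤ m → (k ÷ℕ m) *ℚ toℚ m ≡ toℚ k
÷ℕ-*-cancel {m = zero} z≤n = refl
÷ℕ-*-cancel {k} {suc m} _ = begin
  toℚ k *ℚ 1/ d *ℚ d   ≡⟨ ℚ.*-assoc (toℚ k) (1/ d) d ⟩
  toℚ k *ℚ (1/ d *ℚ d) ≡⟨ cong (toℚ k *ℚ_) (ℚ.*-inverseˡ d) ⟩
  toℚ k *ℚ 1ℚ          ≡⟨ ℚ.*-identityʳ (toℚ k) ⟩
  toℚ k                ∎
  where
  open ≡-Reasoning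
  d = toℚ (suc m)
  instance _ = toℚ-suc-nonZero m

0÷ℕ : ∀ m → 0 ÷ℕ m ≡ 0ℚ
0÷ℕ zero    = refl
0÷ℕ (suc m) = ℚ.*-zeroˡ ((1/ toℚ (suc m)) {{toℚ-suc-nonZero m}})

÷ℕ≤1 : ∀ {k m} → k ≤ m → k ÷ℕ m ≤ℚ 1ℚ
÷ℕ≤1 {m = zero}  _   = ℚ.<⇒≤ (ℚ.positive⁻¹ 1ℚ)
÷ℕ≤1 {k} {suc m} k≤m =
  ℚ.*-cancelʳ-≤-pos (toℚ (suc m)) {{positive (toℚ-pos {suc m} (s≤s z≤n))}} (begin
  (k ÷ℕ suc m) *ℚ toℚ (suc m) ≡⟨ ÷ℕ-*-cancel k≤m ⟩
  toℚ k                       ≤⟨ toℚ-mono-≤ k≤m ⟩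
  toℚ (suc m)                 ≡⟨ ℚ.*-identityˡ (toℚ (suc m)) ⟨
  1ℚ *ℚ toℚ (suc m)           ∎)
  where open ℚ.≤-Reasoning

^ℚ-+ : ∀ x m n → x ^ℚ (m + n) ≡ x ^ℚ m *ℚ x ^ℚ n
^ℚ-+ x zero    n = sym (ℚ.*-identityˡ (x ^ℚ n))
^ℚ-+ x (suc m) n = begin
  x *ℚ x ^ℚ (m + n)           ≡⟨ cong (x *ℚ_) (^ℚ-+ x m n) ⟩
  x *ℚ (x ^ℚ m *ℚ x ^ℚ n)     ≡⟨ ℚ.*-assoc x (x ^ℚ m) (x ^ℚ n) ⟨
  x *ℚ x ^ℚ m *ℚ x ^ℚ n       ∎
  where open ≡-Reasoning

^ℚ-inverse : ∀ {x y} → x *ℚ y ≡ 1ℚ → ∀ k → x ^ℚ k *ℚ y ^ℚ k ≡ 1ℚ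
^ℚ-inverse xy≡1 zero    = refl
^ℚ-inverse {x} {y} xy≡1 (suc k) = begin
  x *ℚ x ^ℚ k *ℚ (y *ℚ y ^ℚ k)   ≡⟨ solve 4 (λ x y a b → (x :* a) :* (y :* b) := (x :* y) :* (a :* b))
                                          refl x y (x ^ℚ k) (y ^ℚ k) ⟩
  x *ℚ y *ℚ (x ^ℚ k *ℚ y ^ℚ k)   ≡⟨ cong₂ _*ℚ_ xy≡1 (^ℚ-inverse xy≡1 k) ⟩
  1ℚ *ℚ 1ℚ                       ≡⟨⟩
  1ℚ                             ∎
  where open ≡-Reasoning

1≤^ℚ : ∀ {x} → 1ℚ ≤ℚ x → ∀ k → 1ℚ ≤ℚ x ^ℚ k
1≤^ℚ 1≤x zero    = ℚ.≤-refl
1≤^ℚ {x} 1≤x (suc k) = begin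
  1ℚ            ≤⟨ 1≤x ⟩
  x             ≡⟨ ℚ.*-identityʳ x ⟨
  x *ℚ 1ℚ       ≤⟨ ℚ.*-monoˡ-≤-nonNeg x {{nonNegative (ℚ.<⇒≤ (1≤⇒0< 1≤x))}} (1≤^ℚ 1≤x k) ⟩
  x *ℚ x ^ℚ k   ∎
  where open ℚ.≤-Reasoning

^ℚ-monoʳ-≤ : ∀ {x} → 1ℚ ≤ℚ x → ∀ {m n} → m ≤ n → x ^ℚ m ≤ℚ x ^ℚ n
^ℚ-monoʳ-≤ {x} 1≤x {m} m≤n with ℕ.m≤n⇒∃[o]m+o≡n m≤n
... | o , refl = begin
  x ^ℚ m              ≡⟨ ℚ.*-identityʳ (x ^ℚ m) ⟨
  x ^ℚ m *ℚ 1ℚ        ≤⟨ ℚ.*-monoˡ-≤-nonNeg (x ^ℚ m) {{0≤x^m}} (1≤^ℚ 1≤x o) ⟩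
  x ^ℚ m *ℚ x ^ℚ o    ≡⟨ ^ℚ-+ x m o ⟨
  x ^ℚ (m + o)        ∎
  where
  open ℚ.≤-Reasoning
  0≤x^m = nonNegative (ℚ.<⇒≤ (1≤⇒0< (1≤^ℚ 1≤x m)))

*-cross : ∀ {a b c d x y} → a *ℚ c ≡ 1ℚ → b *ℚ d ≡ 1ℚ → 0ℚ ≤ℚ c *ℚ d →
          x *ℚ a ≤ℚ y *ℚ b → x *ℚ d ≤ℚ y *ℚ c
*-cross {a} {b} {c} {d} {x} {y} ac≡1 bd≡1 0≤cd xa≤yb = begin
  x *ℚ d                     ≡⟨ cong (x *ℚ_) (ℚ.*-identityˡ d) ⟨
  x *ℚ (1ℚ *ℚ d)             ≡⟨ cong (λ e → x *ℚ (e *ℚ d)) ac≡1 ⟨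
  x *ℚ (a *ℚ c *ℚ d)         ≡⟨ solve 4 (λ x a c d → x :* ((a :* c) :* d) := (x :* a) :* (c :* d))
                                       refl x a c d ⟩
  x *ℚ a *ℚ (c *ℚ d)         ≤⟨ ℚ.*-monoʳ-≤-nonNeg (c *ℚ d) {{nonNegative 0≤cd}} xa≤yb ⟩
  y *ℚ b *ℚ (c *ℚ d)         ≡⟨ solve 4 (λ y b c d → (y :* b) :* (c :* d) := (y :* c) :* (b :* d))
                                       refl y b c d ⟩
  y *ℚ c *ℚ (b *ℚ d)         ≡⟨ cong (y *ℚ c *ℚ_) bd≡1 ⟩
  y *ℚ c *ℚ 1ℚ               ≡⟨ ℚ.*-identityʳ (y *ℚ c) ⟩
  y *ℚ c                     ∎
  where open ℚ.≤-Reasoning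

÷ℕ-cross : ∀ {k m k′ m′} c → k ≤ m → k′ ≤ m′ → k ÷ℕ m ≤ℚ c *ℚ (k′ ÷ℕ m′) →
           toℚ k *ℚ toℚ m′ ≤ℚ c *ℚ toℚ m *ℚ toℚ k′
÷ℕ-cross {k} {m} {k′} {m′} c k≤m k′≤m′ ρ≤cρ′ = begin
  toℚ k *ℚ toℚ m′                  ≡⟨ cong (_*ℚ toℚ m′) (÷ℕ-*-cancel k≤m) ⟨
  ρ *ℚ toℚ m *ℚ toℚ m′             ≡⟨ ℚ.*-assoc ρ (toℚ m) (toℚ m′) ⟩
  ρ *ℚ (toℚ m *ℚ toℚ m′)           ≤⟨ ℚ.*-monoʳ-≤-nonNeg (toℚ m *ℚ toℚ m′) {{mm′-nonNeg}} ρ≤cρ′ ⟩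
  c *ℚ ρ′ *ℚ (toℚ m *ℚ toℚ m′)     ≡⟨ solve 4 (λ c ρ′ m m′ → (c :* ρ′) :* (m :* m′) := (c :* m) :* (ρ′ :* m′))
                                             refl c ρ′ (toℚ m) (toℚ m′) ⟩
  c *ℚ toℚ m *ℚ (ρ′ *ℚ toℚ m′)     ≡⟨ cong (c *ℚ toℚ m *ℚ_) (÷ℕ-*-cancel k′≤m′) ⟩
  c *ℚ toℚ m *ℚ toℚ k′             ∎
  where
  open ℚ.≤-Reasoning
  ρ = k ÷ℕ m
  ρ′ = k′ ÷ℕ m′
  mm′-nonNeg = nonNegative (*-nonNeg (toℚ-nonNeg m) (toℚ-nonNeg m′))

allSubsets-complete : (X : Subset n) → X ∈ allSubsets n
allSubsets-complete []            = here refl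
allSubsets-complete (outside ∷ X) = ∈-++⁺ˡ (∈-map⁺ (outside ∷_) (allSubsets-complete X))
allSubsets-complete {suc n} (inside ∷ X) =
  ∈-++⁺ʳ (map (outside ∷_) (allSubsets n)) (∈-map⁺ (inside ∷_) (allSubsets-complete X))

anyL≡any : ∀ {B : Set} (p : B → Bool) xs → anyL p xs ≡ any p xs
anyL≡any p []       = refl
anyL≡any p (x ∷ xs) = cong (p x ∨_) (anyL≡any p xs)

⊆ᵇ⇒⊆ : (X Y : Subset n) → T (X ⊆ᵇ Y) → X ⊆ Y
⊆ᵇ⇒⊆ []            []           _ = ⊆-refl
⊆ᵇ⇒⊆ (outside ∷ X) (_ ∷ Y)      h = out⊆ (⊆ᵇ⇒⊆ X Y h)
⊆ᵇ⇒⊆ (inside ∷ X)  (inside ∷ Y) h = in⊆in (⊆ᵇ⇒⊆ X Y h)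

⊆⇒⊆ᵇ : (X Y : Subset n) → X ⊆ Y → T (X ⊆ᵇ Y)
⊆⇒⊆ᵇ []            []            _   = tt
⊆⇒⊆ᵇ (outside ∷ X) (_ ∷ Y)       X⊆Y = ⊆⇒⊆ᵇ X Y (drop-∷-⊆ X⊆Y)
⊆⇒⊆ᵇ (inside ∷ X)  (inside ∷ Y)  X⊆Y = ⊆⇒⊆ᵇ X Y (drop-∷-⊆ X⊆Y)
⊆⇒⊆ᵇ (inside ∷ X)  (outside ∷ Y) X⊆Y with () ← X⊆Y Vec.here

==ᵇ⇒≡ : (X Y : Subset n) → T (X ==ᵇ Y) → X ≡ Y
==ᵇ⇒≡ []            []            _ = refl
==ᵇ⇒≡ (inside ∷ X)  (inside ∷ Y)  h = cong (inside ∷_) (==ᵇ⇒≡ X Y h)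
==ᵇ⇒≡ (outside ∷ X) (outside ∷ Y) h = cong (outside ∷_) (==ᵇ⇒≡ X Y h)

==ᵇ-refl : (X : Subset n) → T (X ==ᵇ X)
==ᵇ-refl []            = tt
==ᵇ-refl (inside ∷ X)  = ==ᵇ-refl X
==ᵇ-refl (outside ∷ X) = ==ᵇ-refl X

∖∅ : (A : Subset n) → A ∖ ∅ ≡ A
∖∅ {n} A = trans (cong (A ∩_) (map-replicate not outside n)) (∩-identityʳ A)

∖-∖ : (A S S′ : Subset n) → (A ∖ S) ∖ S′ ≡ A ∖ (S ∪ S′)
∖-∖ []      []      []        = refl
∖-∖ (a ∷ A) (s ∷ S) (s′ ∷ S′) = cong₂ _∷_ (lemma a s s′) (∖-∖ A S S′)
  where
  lemma : ∀ a s s′ → (a ∧ not s) ∧ not s′ ≡ a ∧ not (s ∨ s′)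
  lemma true  true  _ = refl
  lemma true  false _ = refl
  lemma false _     _ = refl

∣∪∣-disjoint : (S S′ : Subset n) → S′ ⊆ ∁ S → ∣ S ∪ S′ ∣ ≡ ∣ S ∣ + ∣ S′ ∣
∣∪∣-disjoint []            []             _ = refl
∣∪∣-disjoint (inside ∷ S)  (inside ∷ S′)  S′⊆∁S with () ← S′⊆∁S Vec.here
∣∪∣-disjoint (inside ∷ S)  (outside ∷ S′) S′⊆∁S = cong suc (∣∪∣-disjoint S S′ (drop-∷-⊆ S′⊆∁S))
∣∪∣-disjoint (outside ∷ S) (inside ∷ S′)  S′⊆∁S =
  trans (cong suc (∣∪∣-disjoint S S′ (drop-∷-⊆ S′⊆∁S))) (sym (ℕ.+-suc ∣ S ∣ ∣ S′ ∣))
∣∪∣-disjoint (outside ∷ S) (outside ∷ S′) S′⊆∁S = ∣∪∣-disjoint S S′ (drop-∷-⊆ S′⊆∁S)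

∪-⊆ : (S S′ : Subset n) → S ⊆ A → S′ ⊆ A → S ∪ S′ ⊆ A
∪-⊆ S S′ S⊆A S′⊆A x∈S∪S′ = [ S⊆A , S′⊆A ]′ (x∈p∪q⁻ S S′ x∈S∪S′)

T-not⇒¬T : ∀ {b} → T (not b) → ¬ T b
T-not⇒¬T {false} _ ()

¬T⇒T-not : ∀ {b} → ¬ T b → T (not b)
¬T⇒T-not {false} _  = tt
¬T⇒T-not {true}  ¬t = ¬t tt

count : Family n → List (Subset n) → ℕ
count F = foldr (λ X k → (if F X then 1 else 0) + k) 0

count-mono : F ⊆F G → ∀ L → count F L ≤ count G L
count-mono F⊆G [] = z≤n
count-mono {F = F} {G = G} F⊆G (X ∷ L) with F X in FX | G X in GX
... | true  | true  = s≤s (count-mono F⊆G L)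
... | false | true  = ℕ.m≤n⇒m≤1+n (count-mono F⊆G L)
... | false | false = count-mono F⊆G L
... | true  | false with () ← subst T GX (F⊆G X (from T-≡ FX))

count-strict : F ⊆F G → ∀ {L X} → X ∈ L → T (G X) → ¬ T (F X) → count F L < count G L
count-strict {F = F} {G = G} F⊆G {X ∷ L} (here refl) GX ¬FX with F X | G X
... | true  | _    = ⊥-elim (¬FX tt)
... | false | true = s≤s (count-mono F⊆G L)
count-strict {F = F} {G = G} F⊆G {Y ∷ L} (there X∈L) GX ¬FX with F Y in FY | G Y in GY
... | true  | true  = s≤s (count-strict F⊆G X∈L GX ¬FX)
... | false | true  = ℕ.m≤n⇒m≤1+n (count-strict F⊆G X∈L GX ¬FX)
... | false | false = count-strict F⊆G X∈L GX ¬FX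
... | true  | false with () ← subst T GY (F⊆G Y (from T-≡ FY))

count-nonempty : ∀ L → 0 < count F L → ∃ λ X → T (F X)
count-nonempty {F = F} (X ∷ L) pos with F X in FX
... | true  = X , from T-≡ FX
... | false = count-nonempty L pos

restrict-sound : ∀ (G : Family n) S X → T (restrict G S X) → ∃ λ A → T (G A) × S ⊆ A × A ∖ S ≡ X
restrict-sound {n} G S X h =
  let A , t     = satisfied (any⁻ p (allSubsets n) (subst T (anyL≡any p (allSubsets n)) h))
      GA , t′   = to T-∧ t
      S⊆A , A∖S = to T-∧ t′
  in A , GA , ⊆ᵇ⇒⊆ S A S⊆A , ==ᵇ⇒≡ (A ∖ S) X A∖S
  where p = λ A → G A ∧ (S ⊆ᵇ A) ∧ ((A ∖ S) ==ᵇ X)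

restrict-complete : ∀ (G : Family n) S {A} → T (G A) → S ⊆ A → T (restrict G S (A ∖ S))
restrict-complete {n} G S {A} GA S⊆A =
  subst T (sym (anyL≡any p (allSubsets n))) (any⁺ p (lose (allSubsets-complete A)
    (from T-∧ (GA , from T-∧ (⊆⇒⊆ᵇ S A S⊆A , ==ᵇ-refl (A ∖ S))))))
  where p = λ B → G B ∧ (S ⊆ᵇ B) ∧ ((B ∖ S) ==ᵇ (A ∖ S))

restrict-mono : F ⊆F G → ∀ S → restrict F S ⊆F restrict G S
restrict-mono {F = F} {G = G} F⊆G S X h with restrict-sound F S X h
... | A , FA , S⊆A , refl = restrict-complete G S (F⊆G A FA) S⊆A

restrict-∅⁺ : G ⊆F restrict G ∅
restrict-∅⁺ {G = G} X GX = subst (T ∘ restrict G ∅) (∖∅ X) (restrict-complete G ∅ GX ⊥⊆)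

restrict-∅⁻ : restrict G ∅ ⊆F G
restrict-∅⁻ {G = G} X h with restrict-sound G ∅ X h
... | A , GA , _ , refl = subst (T ∘ G) (sym (∖∅ A)) GA

restrict-restrict⁺ : ∀ S S′ → restrict (restrict G S) S′ ⊆F restrict G (S ∪ S′)
restrict-restrict⁺ {G = G} S S′ X h with restrict-sound (restrict G S) S′ X h
... | Y , GSY , S′⊆Y , refl with restrict-sound G S Y GSY
... | A , GA , S⊆A , refl = subst (T ∘ restrict G (S ∪ S′)) (sym (∖-∖ A S S′))
  (restrict-complete G (S ∪ S′) GA (∪-⊆ S S′ S⊆A (⊆-trans S′⊆Y (p∩q⊆p A (∁ S)))))

restrict-restrict⁻ : ∀ S S′ → S′ ⊆ ∁ S → restrict G (S ∪ S′) ⊆F restrict (restrict G S) S′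
restrict-restrict⁻ {G = G} S S′ S′⊆∁S X h with restrict-sound G (S ∪ S′) X h
... | A , GA , S∪S′⊆A , refl = subst (T ∘ restrict (restrict G S) S′) (∖-∖ A S S′)
  (restrict-complete (restrict G S) S′ (restrict-complete G S GA (⊆-trans (p⊆p∪q S′) S∪S′⊆A))
    λ x∈S′ → x∈p∩q⁺ (S∪S′⊆A (q⊆p∪q S S′ x∈S′) , S′⊆∁S x∈S′))

restrict-restrict⇒disjoint : ∀ S S′ X → T (restrict (restrict G S) S′ X) → S′ ⊆ ∁ S
restrict-restrict⇒disjoint {G = G} S S′ X h with restrict-sound (restrict G S) S′ X h
... | Y , GSY , S′⊆Y , refl with restrict-sound G S Y GSY
... | A , _ , _ , refl = ⊆-trans S′⊆Y (p∩q⊆q A (∁ S))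

card-cong : F ⊆F G → G ⊆F F → card F ≡ card G
card-cong {n} F⊆G G⊆F = ℕ.≤-antisym (count-mono F⊆G (allSubsets n)) (count-mono G⊆F (allSubsets n))

card-empty : (∀ X → ¬ T (G X)) → card G ≡ 0
card-empty {n} ¬G = ℕ.n≤0⇒n≡0 (ℕ.≮⇒≥ λ pos → let X , GX = count-nonempty (allSubsets n) pos in ¬G X GX)

card-restrict-∅ : ∀ G → card (restrict {n} G ∅) ≡ card G
card-restrict-∅ G = card-cong restrict-∅⁻ (restrict-∅⁺ {G = G})

avoiding : Subset n → Family n → Family n
avoiding S ℱ A = ℱ A ∧ not (S ⊆ᵇ A)

avoiding⊆ : ∀ (S : Subset n) ℱ → avoiding S ℱ ⊆F ℱ
avoiding⊆ S ℱ A h = proj₁ (to T-∧ h)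

avoiding-shrinks : ∀ (S : Subset n) ℱ → 0 < card (restrict ℱ S) → card (avoiding S ℱ) < card ℱ
avoiding-shrinks {n} S ℱ pos
  with X , ℱSX ← count-nonempty (allSubsets n) pos
  with A , ℱA , S⊆A , _ ← restrict-sound ℱ S X ℱSX
  = count-strict (avoiding⊆ S ℱ) (allSubsets-complete A) ℱA ¬avoids
  where
  ¬avoids : ¬ T (avoiding S ℱ A)
  ¬avoids h = T-not⇒¬T (proj₂ (to (T-∧ {ℱ A}) h)) (⊆⇒⊆ᵇ S A S⊆A)

module Greedy (𝒜 : Family n) (τ : ℚ) (1≤τ : 1ℚ ≤ℚ τ) (q : ℕ) where

  Small : Family n → Set
  Small ℱ = τ ^ℚ suc q *ℚ toℚ (card ℱ) ≤ℚ toℚ (card 𝒜)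

  ¬Small⇒nonempty : ∀ ℱ → ¬ Small ℱ → 0 < card ℱ
  ¬Small⇒nonempty ℱ large = ℕ.n≢0⇒n>0 λ empty → large (begin
    τ ^ℚ suc q *ℚ toℚ (card ℱ) ≡⟨ cong (λ m → τ ^ℚ suc q *ℚ toℚ m) empty ⟩
    τ ^ℚ suc q *ℚ 0ℚ           ≡⟨ ℚ.*-zeroʳ (τ ^ℚ suc q) ⟩
    0ℚ                         ≤⟨ toℚ-nonNeg (card 𝒜) ⟩
    toℚ (card 𝒜)               ∎)
    where open ℚ.≤-Reasoning

  HomogeneousAt : Family n → Subset n → Set
  HomogeneousAt ℱ B = Σ (Family n) λ ℱB → ℱB ⊆F ℱ × Homogeneous (restrict ℱB B) (restrict 𝒜 B) τ

  record Decomposition (ℱ : Family n) : Set where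
    field
      𝒮 ℱ′        : Family n
      𝒮-small     : ∀ B → T (𝒮 B) → ∣ B ∣ ≤ q
      ℱ′⊆ℱ        : ℱ′ ⊆F ℱ
      covers      : ∀ A → T (ℱ A) → T (not (ℱ′ A)) → ∃ λ B → T (𝒮 B) × B ⊆ A
      homogeneous : ∀ B → T (𝒮 B) → HomogeneousAt ℱ B
      ℱ′-small    : Small ℱ′

  open Decomposition

  trivial : ∀ ℱ → Small ℱ → Decomposition ℱ
  trivial ℱ small .𝒮 _             = false
  trivial ℱ small .ℱ′              = ℱ
  trivial ℱ small .𝒮-small _ ()
  trivial ℱ small .ℱ′⊆ℱ _ ℱA       = ℱA
  trivial ℱ small .covers A ℱA ¬ℱA = ⊥-elim (T-not⇒¬T ¬ℱA ℱA)
  trivial ℱ small .homogeneous _ ()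
  trivial ℱ small .ℱ′-small        = small

  extend : ∀ ℱ S → ∣ S ∣ ≤ q → Homogeneous (restrict ℱ S) (restrict 𝒜 S) τ →
           Decomposition (avoiding S ℱ) → Decomposition ℱ
  extend ℱ S small-S hom-S D .𝒮 X   = (S ==ᵇ X) ∨ D .𝒮 X
  extend ℱ S small-S hom-S D .ℱ′    = D .ℱ′
  extend ℱ S small-S hom-S D .𝒮-small B h = [ at-S , D .𝒮-small B ]′ (to (T-∨ {S ==ᵇ B}) h)
    where
    at-S : T (S ==ᵇ B) → ∣ B ∣ ≤ q
    at-S S≡B = subst (λ B → ∣ B ∣ ≤ q) (==ᵇ⇒≡ S B S≡B) small-S
  extend ℱ S small-S hom-S D .ℱ′⊆ℱ A h = avoiding⊆ S ℱ A (D .ℱ′⊆ℱ A h)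
  extend ℱ S small-S hom-S D .covers A ℱA ¬ℱ′A = [ at-S , from-D ]′ (toSum (S ⊆? A))
    where
    at-S : S ⊆ A → ∃ λ B → T ((S ==ᵇ B) ∨ D .𝒮 B) × B ⊆ A
    at-S S⊆A = S , from (T-∨ {S ==ᵇ S}) (inj₁ (==ᵇ-refl S)) , S⊆A
    from-D : ¬ S ⊆ A → ∃ λ B → T ((S ==ᵇ B) ∨ D .𝒮 B) × B ⊆ A
    from-D S⊈A =
      let B , 𝒮B , B⊆A = D .covers A (from T-∧ (ℱA , ¬T⇒T-not (S⊈A ∘ ⊆ᵇ⇒⊆ S A))) ¬ℱ′A
      in B , from (T-∨ {S ==ᵇ B}) (inj₂ 𝒮B) , B⊆A
  extend ℱ S small-S hom-S D .homogeneous B h = [ at-S , from-D ]′ (to (T-∨ {S ==ᵇ B}) h)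
    where
    at-S : T (S ==ᵇ B) → HomogeneousAt ℱ B
    at-S S≡B = subst (HomogeneousAt ℱ) (==ᵇ⇒≡ S B S≡B) (ℱ , (λ _ ℱA → ℱA) , hom-S)
    from-D : T (D .𝒮 B) → HomogeneousAt ℱ B
    from-D 𝒮B = let ℱB , ℱB⊆ , hom-B = D .homogeneous B 𝒮B
                in ℱB , (λ A ℱBA → avoiding⊆ S ℱ A (ℱB⊆ A ℱBA)) , hom-B
  extend ℱ S small-S hom-S D .ℱ′-small = D .ℱ′-small

  instance
    τ-nonZero : NonZero τ
    τ-nonZero = >-nonZero (1≤⇒0< 1≤τ)

  τ⁻¹ : ℚ
  τ⁻¹ = 1/ τ

  τ^-pos : ∀ k → 0ℚ <ℚ τ ^ℚ k
  τ^-pos k = 1≤⇒0< (1≤^ℚ 1≤τ k)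

  module Densest (ℱ : Family n) (ℱ⊆𝒜 : ℱ ⊆F 𝒜) where

    f a : Subset n → ℕ
    f S = card (restrict ℱ S)
    a S = card (restrict 𝒜 S)

    f≤a : ∀ S → f S ≤ a S
    f≤a S = count-mono (restrict-mono ℱ⊆𝒜 S) (allSubsets n)

    ratio : Subset n → ℚ
    ratio S = f S ÷ℕ a S

    density : Subset n → ℚ
    density S = ratio S *ℚ τ⁻¹ ^ℚ ∣ S ∣

    densest : Subset n
    densest = argmax density ∅ (allSubsets n)

    density≤densest : ∀ U → density U ≤ℚ density densest
    density≤densest U =
      All.lookup (f[xs]≤f[argmax] {f = density} ∅ (allSubsets n)) (allSubsets-complete U)

    density-cross : ∀ {U S} → density U ≤ℚ density S →
                    ratio U *ℚ τ ^ℚ ∣ S ∣ ≤ℚ ratio S *ℚ τ ^ℚ ∣ U ∣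
    density-cross {U} {S} = *-cross {x = ratio U} {y = ratio S}
      (^ℚ-inverse (ℚ.*-inverseˡ τ) ∣ U ∣) (^ℚ-inverse (ℚ.*-inverseˡ τ) ∣ S ∣)
      (*-nonNeg (ℚ.<⇒≤ (τ^-pos ∣ U ∣)) (ℚ.<⇒≤ (τ^-pos ∣ S ∣)))

    densest-bound : τ ^ℚ ∣ densest ∣ *ℚ toℚ (card ℱ) ≤ℚ ratio densest *ℚ toℚ (card 𝒜)
    densest-bound = begin
      t *ℚ toℚ (card ℱ)              ≡⟨ cong (λ m → t *ℚ toℚ m) (card-restrict-∅ ℱ) ⟨
      t *ℚ toℚ (f ∅)                 ≡⟨ cong (t *ℚ_) (÷ℕ-*-cancel (f≤a ∅)) ⟨
      t *ℚ (ratio ∅ *ℚ toℚ (a ∅))    ≡⟨ solve 3 (λ t r m → t :* (r :* m) := (r :* t) :* m)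
                                              refl t (ratio ∅) (toℚ (a ∅)) ⟩
      ratio ∅ *ℚ t *ℚ toℚ (a ∅)      ≤⟨ *-monoʳ-≤-toℚ (a ∅) (density-cross (density≤densest ∅)) ⟩
      r *ℚ τ ^ℚ ∣ ∅ {n} ∣ *ℚ toℚ (a ∅) ≡⟨ cong (λ k → r *ℚ τ ^ℚ k *ℚ toℚ (a ∅)) (∣⊥∣≡0 n) ⟩
      r *ℚ 1ℚ *ℚ toℚ (a ∅)           ≡⟨ cong (_*ℚ toℚ (a ∅)) (ℚ.*-identityʳ r) ⟩
      r *ℚ toℚ (a ∅)                 ≡⟨ cong (λ m → r *ℚ toℚ m) (card-restrict-∅ 𝒜) ⟩
      r *ℚ toℚ (card 𝒜)              ∎
      where
      open ℚ.≤-Reasoning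
      t = τ ^ℚ ∣ densest ∣
      r = ratio densest

    densest-small : ¬ Small ℱ → ∣ densest ∣ ≤ q
    densest-small large = ℕ.≮⇒≥ λ q<∣densest∣ → large (begin
      τ ^ℚ suc q *ℚ toℚ (card ℱ)       ≤⟨ *-monoʳ-≤-toℚ (card ℱ) (^ℚ-monoʳ-≤ 1≤τ q<∣densest∣) ⟩
      τ ^ℚ ∣ densest ∣ *ℚ toℚ (card ℱ) ≤⟨ densest-bound ⟩
      ratio densest *ℚ toℚ (card 𝒜)    ≤⟨ *-monoʳ-≤-toℚ (card 𝒜) (÷ℕ≤1 (f≤a densest)) ⟩
      1ℚ *ℚ toℚ (card 𝒜)               ≡⟨ ℚ.*-identityˡ (toℚ (card 𝒜)) ⟩
      toℚ (card 𝒜)                     ∎)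
      where open ℚ.≤-Reasoning

    densest-nonempty : ¬ Small ℱ → 0 < f densest
    densest-nonempty large = ℕ.n≢0⇒n>0 λ f≡0 → ℚ.<-irrefl refl (begin-strict
      0ℚ                               <⟨ *-pos (τ^-pos ∣ densest ∣) (toℚ-pos (¬Small⇒nonempty ℱ large)) ⟩
      τ ^ℚ ∣ densest ∣ *ℚ toℚ (card ℱ) ≤⟨ densest-bound ⟩
      ratio densest *ℚ toℚ (card 𝒜)    ≡⟨ cong (_*ℚ toℚ (card 𝒜)) (ratio≡0 f≡0) ⟩
      0ℚ *ℚ toℚ (card 𝒜)               ≡⟨ ℚ.*-zeroˡ (toℚ (card 𝒜)) ⟩
      0ℚ                               ∎)
      where
      open ℚ.≤-Reasoning
      ratio≡0 : f densest ≡ 0 → ratio densest ≡ 0ℚ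
      ratio≡0 f≡0 = trans (cong (_÷ℕ a densest) f≡0) (0÷ℕ (a densest))

    module _ (S : Subset n) (maximal : ∀ U → density U ≤ℚ density S) where

      disjoint-ratio : ∀ S′ → S′ ⊆ ∁ S → ratio (S ∪ S′) ≤ℚ τ ^ℚ ∣ S′ ∣ *ℚ ratio S
      disjoint-ratio S′ S′⊆∁S = ℚ.*-cancelʳ-≤-pos (τ ^ℚ ∣ S ∣) {{positive (τ^-pos ∣ S ∣)}} (begin
        ratio (S ∪ S′) *ℚ τ ^ℚ ∣ S ∣           ≤⟨ density-cross (maximal (S ∪ S′)) ⟩
        ratio S *ℚ τ ^ℚ ∣ S ∪ S′ ∣             ≡⟨ cong (λ k → ratio S *ℚ τ ^ℚ k) (∣∪∣-disjoint S S′ S′⊆∁S) ⟩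
        ratio S *ℚ τ ^ℚ (∣ S ∣ + ∣ S′ ∣)       ≡⟨ cong (ratio S *ℚ_) (^ℚ-+ τ ∣ S ∣ ∣ S′ ∣) ⟩
        ratio S *ℚ (τ ^ℚ ∣ S ∣ *ℚ τ ^ℚ ∣ S′ ∣) ≡⟨ solve 3 (λ r t t′ → r :* (t :* t′) := (t′ :* r) :* t)
                                                    refl (ratio S) (τ ^ℚ ∣ S ∣) (τ ^ℚ ∣ S′ ∣) ⟩
        τ ^ℚ ∣ S′ ∣ *ℚ ratio S *ℚ τ ^ℚ ∣ S ∣   ∎)
        where open ℚ.≤-Reasoning

      HomogeneityBound : Subset n → Set
      HomogeneityBound S′ =
        toℚ (card (restrict (restrict ℱ S) S′)) *ℚ toℚ (a S)
          ≤ℚ τ ^ℚ ∣ S′ ∣ *ℚ toℚ (card (restrict (restrict 𝒜 S) S′)) *ℚ toℚ (f S)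

      disjoint-bound : ∀ S′ → S′ ⊆ ∁ S → HomogeneityBound S′
      disjoint-bound S′ S′⊆∁S =
        subst₂ (λ k m → toℚ k *ℚ toℚ (a S) ≤ℚ τ ^ℚ ∣ S′ ∣ *ℚ toℚ m *ℚ toℚ (f S))
          (card-cong (restrict-restrict⁻ {G = ℱ} S S′ S′⊆∁S) (restrict-restrict⁺ {G = ℱ} S S′))
          (card-cong (restrict-restrict⁻ {G = 𝒜} S S′ S′⊆∁S) (restrict-restrict⁺ {G = 𝒜} S S′))
          (÷ℕ-cross (τ ^ℚ ∣ S′ ∣) (f≤a (S ∪ S′)) (f≤a S) (disjoint-ratio S′ S′⊆∁S))

      overlapping-bound : ∀ S′ → ¬ S′ ⊆ ∁ S → HomogeneityBound S′
      overlapping-bound S′ S′⊈∁S = begin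
        toℚ (card ℱSS′) *ℚ toℚ (a S)            ≡⟨ cong (λ k → toℚ k *ℚ toℚ (a S)) ℱSS′-empty ⟩
        0ℚ *ℚ toℚ (a S)                         ≡⟨ ℚ.*-zeroˡ (toℚ (a S)) ⟩
        0ℚ                                      ≤⟨ *-nonNeg (*-nonNeg 0≤t (toℚ-nonNeg (card 𝒜SS′)))
                                                            (toℚ-nonNeg (f S)) ⟩
        τ ^ℚ ∣ S′ ∣ *ℚ toℚ (card 𝒜SS′) *ℚ toℚ (f S) ∎
        where
        open ℚ.≤-Reasoning
        ℱSS′ = restrict (restrict ℱ S) S′
        𝒜SS′ = restrict (restrict 𝒜 S) S′
        0≤t = ℚ.<⇒≤ (τ^-pos ∣ S′ ∣)
        ℱSS′-empty : card ℱSS′ ≡ 0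
        ℱSS′-empty = card-empty {G = ℱSS′} λ X h → S′⊈∁S (restrict-restrict⇒disjoint {G = ℱ} S S′ X h)

      maximal-homogeneous : 0 < f S → Homogeneous (restrict ℱ S) (restrict 𝒜 S) τ
      maximal-homogeneous f>0 = restrict-mono ℱ⊆𝒜 S , f>0 , λ S′ →
        [ disjoint-bound S′ , overlapping-bound S′ ]′ (toSum (S′ ⊆? ∁ S))

  decompose : ∀ ℱ → ℱ ⊆F 𝒜 → Acc _<_ (card ℱ) → Decomposition ℱ
  decompose ℱ ℱ⊆𝒜 (acc smaller) =
    [ trivial ℱ , peel ]′ (toSum (τ ^ℚ suc q *ℚ toℚ (card ℱ) ℚ.≤? toℚ (card 𝒜)))
    where
    open Densest ℱ ℱ⊆𝒜
    peel : ¬ Small ℱ → Decomposition ℱ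
    peel large =
      extend ℱ densest (densest-small large)
        (maximal-homogeneous densest density≤densest (densest-nonempty large))
        (decompose (avoiding densest ℱ) (λ A h → ℱ⊆𝒜 A (avoiding⊆ densest ℱ A h))
          (smaller (avoiding-shrinks densest ℱ (densest-nonempty large))))

lemma2 : (n : ℕ) (𝒜 : Family n) (τ : ℚ) (q : ℕ) → 1ℚ ≤ℚ τ → 1 ≤ q →
  (ℱ : Family n) → ℱ ⊆F 𝒜 →
  Σ (Family n) λ 𝒮 → Σ (Family n) λ ℱ' →
    (∀ B → T (𝒮 B) → ∣ B ∣ ≤ q) ×
    ℱ' ⊆F ℱ ×
    (∀ A → T (ℱ A) → T (not (ℱ' A)) → ∃ λ B → T (𝒮 B) × B ⊆ A) ×
    (∀ B → T (𝒮 B) → Σ (Family n) λ ℱB → ℱB ⊆F ℱ × Homogeneous (restrict ℱB B) (restrict 𝒜 B) τ) ×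
    ((τ ^ℚ suc q) *ℚ toℚ (card ℱ') ≤ℚ toℚ (card 𝒜))
lemma2 n 𝒜 τ q 1≤τ _ ℱ ℱ⊆𝒜 = 𝒮 , ℱ′ , 𝒮-small , ℱ′⊆ℱ , covers , homogeneous , ℱ′-small
  where
  open Greedy 𝒜 τ 1≤τ q
  open Decomposition (decompose ℱ ℱ⊆𝒜 (<-wellFounded (card ℱ)))
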